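{- If the 2-sequent $\vdash A^{\langle 0,\varnothing\rangle}$ is provable in $2_{\mathsf{LTL}}$, then so are the 2-sequents $\vdash(\Box A)^{\langle 0,\varnothing\rangle}$ and $\vdash(\bigcirc A)^{\langle 0,\varnothing\rangle}$.
   Context: Temporal formulas are built from proposition symbols using $\neg,\wedge,\vee,\to$ and the unary operators $\Box,\Diamond,\bigcirc$ (always, sometime, next). Positions are pairs $\langle n,S\rangle$ with $n\in\mathbb N$ and $S$ a finite set of tokens from a countably infinite set. For $s=\langle n,S\rangle$, $t=\langle m,T\rangle$: $s\oplus t=\langle n+m,S\cup T\rangle$; $s\oplus m$ means $s\oplus\langle m,\varnothing\rangle$; $s\oplus x$ means $s\oplus\langle 0,\{x\}\rangle$. A p-formula is $A^s$; a 2-sequent is $\Gamma\vdash\Delta$ with $\Gamma,\Delta$ finite (possibly empty) sequences of p-formulas; $x\notin s,\Gamma,\Delta$ means the token $x$ belongs to no position in $s,\Gamma,\Delta$. The calculus $2_{\mathsf{LTL}}$: Axiom $A^s\vdash A^s$; unrestricted Cut; weakening, contraction, exchange; classical propositional sequent rules for $\neg,\wedge,\vee,\to$ with all active p-formulas at the same position; temporal rules: from $\Gamma,A^{s\oplus t}\vdash\Delta$ infer $\Gamma,(\Box A)^s\vdash\Delta$ ($t$ any position); from $\Gamma\vdash A^{s\oplus x},\Delta$ infer $\Gamma\vdash(\Box A)^s,\Delta$; from $\Gamma,A^{s\oplus x}\vdash\Delta$ infer $\Gamma,(\Diamond A)^s\vdash\Delta$; from $\Gamma\vdash A^{s\oplus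 t},\Delta$ infer $\Gamma\vdash(\Diamond A)^s,\Delta$; from $\Gamma,A^{s\oplus 1}\vdash\Delta$ infer $\Gamma,(\bigcirc A)^s\vdash\Delta$; from $\Gamma\vdash A^{s\oplus1},\Delta$ infer $\Gamma\vdash(\bigcirc A)^s,\Delta$; IND: from $\Gamma,A^{s\oplus x}\vdash A^{s\oplus x\oplus 1},\Delta$ infer $\Gamma,A^s\vdash A^{s\oplus t},\Delta$. In the right $\Box$ rule, the left $\Diamond$ rule and IND, $x\notin s,\Gamma,\Delta$. -}

module Defs where

open import Data.Nat using (ℕ; zero; suc; _+_)
open import Data.Bool using (Bool; true; false; _∨_)
open import Data.List using (List; []; _∷_; map; any)
open import Data.Unit using (⊤; tt)
open import Data.Empty using (⊥)
open import Data.Product using (_×_; _,_)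
open import Relation.Nullary using (¬_)
open import Data.List.Relation.Unary.Any using (Any)
open import Relation.Binary.PropositionalEquality using (_≡_)

-- A finite set is represented canonically by its
-- characteristic bit list with no trailing 'false', so that
-- propositional equality of representations is set equality.

Token : Set
Token = ℕ

NoTrail : List Bool → Set
NoTrail []               = ⊤
NoTrail (true ∷ [])      = ⊤
NoTrail (false ∷ [])     = ⊥
NoTrail (b ∷ c ∷ l)      = NoTrail (c ∷ l)

record FinSet : Set where
  constructor mkFS
  field
    bits    : List Bool
    .canon  : NoTrail bits
open FinSet public

consT : Bool → List Bool → List Bool
consT true  []      = true ∷ []
consT false []      = []
consT true  (c ∷ l) = true ∷ c ∷ l
consT false (c ∷ l) = false ∷ c ∷ l

trim : List Bool → List Bool
trim []      = []
trim (b ∷ l) = consT b (trim l)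

consT-canon : ∀ b l → NoTrail l → NoTrail (consT b l)
consT-canon true  []      _ = tt
consT-canon false []      _ = tt
consT-canon true  (c ∷ l) p = p
consT-canon false (c ∷ l) p = p

trim-canon : ∀ l → NoTrail (trim l)
trim-canon []      = tt
trim-canon (b ∷ l) = consT-canon b (trim l) (trim-canon l)

orBits : List Bool → List Bool → List Bool
orBits []      m       = m
orBits (b ∷ l) []      = b ∷ l
orBits (b ∷ l) (c ∷ m) = (b ∨ c) ∷ orBits l m

∅ : FinSet
∅ = mkFS [] tt

_∪_ : FinSet → FinSet → FinSet
S ∪ T = mkFS (trim (orBits (bits S) (bits T))) (trim-canon (orBits (bits S) (bits T)))

singletonBits : Token → List Bool
singletonBits zero    = true ∷ []
singletonBits (suc x) = false ∷ singletonBits x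

singleton-canon : ∀ x → NoTrail (singletonBits x)
singleton-canon zero          = tt
singleton-canon (suc zero)    = tt
singleton-canon (suc (suc x)) = singleton-canon (suc x)

｛_｝ : Token → FinSet
｛ x ｝ = mkFS (singletonBits x) (singleton-canon x)

memBits : Token → List Bool → Bool
memBits _       []      = false
memBits zero    (b ∷ _) = b
memBits (suc x) (_ ∷ l) = memBits x l

_∈ₛ_ : Token → FinSet → Set
x ∈ₛ S = memBits x (bits S) ≡ true

record Position : Set where
  constructor ⟨_,_⟩
  field
    num  : ℕ
    toks : FinSet
open Position public

_⊕_ : Position → Position → Position
⟨ n , S ⟩ ⊕ ⟨ m , T ⟩ = ⟨ n + m , S ∪ T ⟩

_⊕ₙ_ : Position → ℕ → Position
s ⊕ₙ m = s ⊕ ⟨ m , ∅ ⟩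

_⊕ₜ_ : Position → Token → Position
s ⊕ₜ x = s ⊕ ⟨ 0 , ｛ x ｝ ⟩

pos₀ : Position
pos₀ = ⟨ 0 , ∅ ⟩

infixr 5 _⇒_
infixr 6 _∨̇_
infixr 7 _∧̇_

data Formula : Set where
  var   : ℕ → Formula
  ¬̇_    : Formula → Formula
  _∧̇_   : Formula → Formula → Formula
  _∨̇_   : Formula → Formula → Formula
  _⇒_   : Formula → Formula → Formula
  □_    : Formula → Formula
  ◇_    : Formula → Formula
  ○_    : Formula → Formula

record PFormula : Set where
  constructor _^_
  field
    form : Formula
    pos  : Position
open PFormula public

_occursIn_ : Token → Position → Set
x occursIn s = x ∈ₛ toks s

_freshFor_ : Token → List PFormula → Set
x freshFor Γ = ¬ Any (λ φ → x occursIn pos φ) Γ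

Fresh : Token → Position → List PFormula → List PFormula → Set
Fresh x s Γ Δ = ¬ (x occursIn s) × x freshFor Γ × x freshFor Δ

open import Data.List using (_++_; [_])

infix 3 _⊢_

data _⊢_ : List PFormula → List PFormula → Set where
  ax     : ∀ {φ} → [ φ ] ⊢ [ φ ]
  cut    : ∀ {Γ Δ Π Σ φ} → Γ ⊢ φ ∷ Δ → Π ++ [ φ ] ⊢ Σ → Π ++ Γ ⊢ Δ ++ Σ
  wkL    : ∀ {Γ Δ φ} → Γ ⊢ Δ → Γ ++ [ φ ] ⊢ Δ
  wkR    : ∀ {Γ Δ φ} → Γ ⊢ Δ → Γ ⊢ φ ∷ Δ
  ctrL   : ∀ {Γ Δ φ} → Γ ++ φ ∷ φ ∷ [] ⊢ Δ → Γ ++ [ φ ] ⊢ Δ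
  ctrR   : ∀ {Γ Δ φ} → Γ ⊢ φ ∷ φ ∷ Δ → Γ ⊢ φ ∷ Δ
  exL    : ∀ {Γ Π Δ φ ψ} → Γ ++ φ ∷ ψ ∷ Π ⊢ Δ → Γ ++ ψ ∷ φ ∷ Π ⊢ Δ
  exR    : ∀ {Γ Δ Σ φ ψ} → Γ ⊢ Δ ++ φ ∷ ψ ∷ Σ → Γ ⊢ Δ ++ ψ ∷ φ ∷ Σ
  ¬L     : ∀ {Γ Δ A s} → Γ ⊢ (A ^ s) ∷ Δ → Γ ++ [ (¬̇ A) ^ s ] ⊢ Δ
  ¬R     : ∀ {Γ Δ A s} → Γ ++ [ A ^ s ] ⊢ Δ → Γ ⊢ ((¬̇ A) ^ s) ∷ Δ
  ∧L₁    : ∀ {Γ Δ A B s} → Γ ++ [ A ^ s ] ⊢ Δ → Γ ++ [ (A ∧̇ B) ^ s ] ⊢ Δ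
  ∧L₂    : ∀ {Γ Δ A B s} → Γ ++ [ B ^ s ] ⊢ Δ → Γ ++ [ (A ∧̇ B) ^ s ] ⊢ Δ
  ∧R     : ∀ {Γ Δ A B s} → Γ ⊢ (A ^ s) ∷ Δ → Γ ⊢ (B ^ s) ∷ Δ → Γ ⊢ ((A ∧̇ B) ^ s) ∷ Δ
  ∨L     : ∀ {Γ Δ A B s} → Γ ++ [ A ^ s ] ⊢ Δ → Γ ++ [ B ^ s ] ⊢ Δ → Γ ++ [ (A ∨̇ B) ^ s ] ⊢ Δ
  ∨R₁    : ∀ {Γ Δ A B s} → Γ ⊢ (A ^ s) ∷ Δ → Γ ⊢ ((A ∨̇ B) ^ s) ∷ Δ
  ∨R₂    : ∀ {Γ Δ A B s} → Γ ⊢ (B ^ s) ∷ Δ → Γ ⊢ ((A ∨̇ B) ^ s) ∷ Δ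
  ⇒L     : ∀ {Γ Δ Π Σ A B s} → Γ ⊢ (A ^ s) ∷ Δ → Π ++ [ B ^ s ] ⊢ Σ →
           (Π ++ Γ) ++ [ (A ⇒ B) ^ s ] ⊢ Δ ++ Σ
  ⇒R     : ∀ {Γ Δ A B s} → Γ ++ [ A ^ s ] ⊢ (B ^ s) ∷ Δ → Γ ⊢ ((A ⇒ B) ^ s) ∷ Δ
  □L     : ∀ {Γ Δ A s} (t : Position) → Γ ++ [ A ^ (s ⊕ t) ] ⊢ Δ → Γ ++ [ (□ A) ^ s ] ⊢ Δ
  □R     : ∀ {Γ Δ A s} (x : Token) → Fresh x s Γ Δ →
           Γ ⊢ (A ^ (s ⊕ₜ x)) ∷ Δ → Γ ⊢ ((□ A) ^ s) ∷ Δ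
  ◇L     : ∀ {Γ Δ A s} (x : Token) → Fresh x s Γ Δ →
           Γ ++ [ A ^ (s ⊕ₜ x) ] ⊢ Δ → Γ ++ [ (◇ A) ^ s ] ⊢ Δ
  ◇R     : ∀ {Γ Δ A s} (t : Position) → Γ ⊢ (A ^ (s ⊕ t)) ∷ Δ → Γ ⊢ ((◇ A) ^ s) ∷ Δ
  ○L     : ∀ {Γ Δ A s} → Γ ++ [ A ^ (s ⊕ₙ 1) ] ⊢ Δ → Γ ++ [ (○ A) ^ s ] ⊢ Δ
  ○R     : ∀ {Γ Δ A s} → Γ ⊢ (A ^ (s ⊕ₙ 1)) ∷ Δ → Γ ⊢ ((○ A) ^ s) ∷ Δ
  ind    : ∀ {Γ Δ A s} (x : Token) (t : Position) → Fresh x s Γ Δ →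
           Γ ++ [ A ^ (s ⊕ₜ x) ] ⊢ (A ^ ((s ⊕ₜ x) ⊕ₙ 1)) ∷ Δ →
           Γ ++ [ A ^ s ] ⊢ (A ^ (s ⊕ t)) ∷ Δ

module Submission where

-- The proof rests on a shifting lemma: adding a fixed position u to
-- every position occurring in a derivation of Γ ⊢ Δ yields a derivation
-- of the shifted sequent, provided no eigen-token of the derivation (the
-- token x of a □R, ◇L or ind inference) occurs in u.  Every rule is
-- stable under the shift because ⊕ is associative and commutative on
-- positions, so an active position (s ⊕ t) ⊕ u can be read as
-- (s ⊕ u) ⊕ t, and because shifting by u cannot make an eigen-token
-- that avoids u occur anywhere.
--
-- The theorem
-- follows by shifting the given derivation by ⟨1,∅⟩ (then ○R), and by
-- ⟨0,{x}⟩ for a token x above all eigen-tokens (then □R with x).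

open import Defs
open import Data.List using (List; []; _∷_; map; _++_; [_])
open import Data.Product using (_×_; ∃; _,_)

open import Algebra using (CommutativeMonoid)
open import Data.Bool using (Bool; true; false; _∨_)
open import Data.Bool.Properties using (∨-commutativeMonoid; ∨-identityʳ)
open import Data.Empty using (⊥-elim)
open import Data.List.Extrema.Nat using (max; xs≤max)
open import Data.List.Properties using (map-++)
open import Data.List.Relation.Unary.All as All using (All; _∷_)
open import Data.List.Relation.Unary.All.Properties using (++⁻ˡ; ++⁻ʳ)
open import Data.List.Relation.Unary.Any as Any using ()
open import Data.List.Relation.Unary.Any.Properties using (map⁻)
open import Data.Nat using (zero; suc; _<_; s≤s)
open import Data.Nat.Properties using (+-commutativeSemigroup)
open import Function using (_∘_)
open import Relation.Nullary using (¬_)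
open import Relation.Binary.PropositionalEquality
  using (_≡_; refl; sym; trans; cong; cong₂; subst; module ≡-Reasoning)

open import Algebra.Properties.CommutativeSemigroup +-commutativeSemigroup
  using () renaming (xy∙z≈xz∙y to +-rightComm)
open import Algebra.Properties.CommutativeSemigroup
  (CommutativeMonoid.commutativeSemigroup ∨-commutativeMonoid)
  using () renaming (xy∙z≈xz∙y to ∨-rightComm)

_∈ᵇ_ : Token → FinSet → Bool
y ∈ᵇ S = memBits y (bits S)

memBits-consT : ∀ y b l → memBits y (consT b l) ≡ memBits y (b ∷ l)
memBits-consT y       true  []      = refl
memBits-consT zero    false []      = refl
memBits-consT (suc y) false []      = refl
memBits-consT y       true  (c ∷ l) = refl
memBits-consT y       false (c ∷ l) = refl

memBits-trim : ∀ y l → memBits y (trim l) ≡ memBits y l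
memBits-trim y       []      = refl
memBits-trim zero    (b ∷ l) = memBits-consT zero b (trim l)
memBits-trim (suc y) (b ∷ l) =
  trans (memBits-consT (suc y) b (trim l)) (memBits-trim y l)

memBits-orBits : ∀ y l m → memBits y (orBits l m) ≡ memBits y l ∨ memBits y m
memBits-orBits y       []      m       = refl
memBits-orBits y       (b ∷ l) []      = sym (∨-identityʳ _)
memBits-orBits zero    (b ∷ l) (c ∷ m) = refl
memBits-orBits (suc y) (b ∷ l) (c ∷ m) = memBits-orBits y l m

∈ᵇ-∪ : ∀ y S T → y ∈ᵇ (S ∪ T) ≡ (y ∈ᵇ S) ∨ (y ∈ᵇ T)
∈ᵇ-∪ y S T =
  trans (memBits-trim y (orBits (bits S) (bits T))) (memBits-orBits y (bits S) (bits T))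

canonical-member : ∀ b l → .(NoTrail (b ∷ l)) → ∃ λ y → memBits y (b ∷ l) ≡ true
canonical-member true  []      _ = zero , refl
canonical-member true  (c ∷ l) _ = zero , refl
canonical-member false (c ∷ l) p with canonical-member c l p
... | y , y∈ = suc y , y∈

.NoTrail-tail : ∀ b l → NoTrail (b ∷ l) → NoTrail l
NoTrail-tail b     []      _ = _
NoTrail-tail true  (c ∷ l) p = p
NoTrail-tail false (c ∷ l) p = p

canonical-ext : ∀ l m → .(NoTrail l) → .(NoTrail m) →
                (∀ y → memBits y l ≡ memBits y m) → l ≡ m
canonical-ext []      []      _  _  _    = refl
canonical-ext []      (c ∷ m) _  cm same with canonical-member c m cm
... | y , y∈m with trans (same y) y∈m
...   | ()
canonical-ext (b ∷ l) []      bl _  same with canonical-member b l bl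
... | y , y∈l with trans (sym (same y)) y∈l
...   | ()
canonical-ext (b ∷ l) (c ∷ m) bl cm same =
  cong₂ _∷_ (same zero)
    (canonical-ext l m (NoTrail-tail b l bl) (NoTrail-tail c m cm) (same ∘ suc))

FinSet-ext : ∀ {S T} → (∀ y → y ∈ᵇ S ≡ y ∈ᵇ T) → S ≡ T
FinSet-ext {mkFS l p} {mkFS m q} same = mkFS-cong (canonical-ext l m p q same)
  where
  mkFS-cong : ∀ {l m} .{p : NoTrail l} .{q : NoTrail m} → l ≡ m → mkFS l p ≡ mkFS m q
  mkFS-cong refl = refl

∪-rightComm : ∀ S T U → (S ∪ T) ∪ U ≡ (S ∪ U) ∪ T
∪-rightComm S T U = FinSet-ext λ y → begin
  y ∈ᵇ ((S ∪ T) ∪ U)               ≡⟨ ∈ᵇ-∪ y (S ∪ T) U ⟩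
  y ∈ᵇ (S ∪ T) ∨ y ∈ᵇ U            ≡⟨ cong (_∨ y ∈ᵇ U) (∈ᵇ-∪ y S T) ⟩
  (y ∈ᵇ S ∨ y ∈ᵇ T) ∨ y ∈ᵇ U       ≡⟨ ∨-rightComm (y ∈ᵇ S) (y ∈ᵇ T) (y ∈ᵇ U) ⟩
  (y ∈ᵇ S ∨ y ∈ᵇ U) ∨ y ∈ᵇ T       ≡⟨ cong (_∨ y ∈ᵇ T) (∈ᵇ-∪ y S U) ⟨
  y ∈ᵇ (S ∪ U) ∨ y ∈ᵇ T            ≡⟨ ∈ᵇ-∪ y (S ∪ U) T ⟨
  y ∈ᵇ ((S ∪ U) ∪ T)               ∎
  where open ≡-Reasoning

⊕-rightComm : ∀ s t u → (s ⊕ t) ⊕ u ≡ (s ⊕ u) ⊕ t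
⊕-rightComm ⟨ n , S ⟩ ⟨ m , T ⟩ ⟨ k , U ⟩ =
  cong₂ ⟨_,_⟩ (+-rightComm n m k) (∪-rightComm S T U)

∨-true-left : ∀ a b → a ∨ b ≡ true → ¬ b ≡ true → a ≡ true
∨-true-left true  b _    _   = refl
∨-true-left false b b≡t  b≢t = ⊥-elim (b≢t b≡t)

occursIn-⊕ : ∀ {x} p u → ¬ x occursIn u → x occursIn (p ⊕ u) → x occursIn p
occursIn-⊕ {x} p u x∉u x∈p⊕u =
  ∨-true-left _ _ (trans (sym (∈ᵇ-∪ x (toks p) (toks u))) x∈p⊕u) x∉u

<-notIn-singleton : ∀ {y x} → y < x → ¬ y occursIn ⟨ 0 , ｛ x ｝ ⟩
<-notIn-singleton {zero}  {suc x} _         ()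
<-notIn-singleton {suc y} {suc x} (s≤s y<x) = <-notIn-singleton y<x

eigentokens : ∀ {Γ Δ} → Γ ⊢ Δ → List Token
eigentokens ax            = []
eigentokens (cut d e)     = eigentokens d ++ eigentokens e
eigentokens (wkL d)       = eigentokens d
eigentokens (wkR d)       = eigentokens d
eigentokens (ctrL d)      = eigentokens d
eigentokens (ctrR d)      = eigentokens d
eigentokens (exL d)       = eigentokens d
eigentokens (exR d)       = eigentokens d
eigentokens (¬L d)        = eigentokens d
eigentokens (¬R d)        = eigentokens d
eigentokens (∧L₁ d)       = eigentokens d
eigentokens (∧L₂ d)       = eigentokens d
eigentokens (∧R d e)      = eigentokens d ++ eigentokens e
eigentokens (∨L d e)      = eigentokens d ++ eigentokens e
eigentokens (∨R₁ d)       = eigentokens d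
eigentokens (∨R₂ d)       = eigentokens d
eigentokens (⇒L d e)      = eigentokens d ++ eigentokens e
eigentokens (⇒R d)        = eigentokens d
eigentokens (□L t d)      = eigentokens d
eigentokens (□R x _ d)    = x ∷ eigentokens d
eigentokens (◇L x _ d)    = x ∷ eigentokens d
eigentokens (◇R t d)      = eigentokens d
eigentokens (○L d)        = eigentokens d
eigentokens (○R d)        = eigentokens d
eigentokens (ind x t _ d) = x ∷ eigentokens d

module Shift (u : Position) where

  shift : PFormula → PFormula
  shift φ = form φ ^ (pos φ ⊕ u)

  ⇑ : List PFormula → List PFormula
  ⇑ = map shift

  Admissible : ∀ {Γ Δ} → Γ ⊢ Δ → Set
  Admissible d = All (λ x → ¬ x occursIn u) (eigentokens d)

  freshFor-⇑ : ∀ {x} Γ → ¬ x occursIn u → x freshFor Γ → x freshFor ⇑ Γ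
  freshFor-⇑ Γ x∉u x∉Γ = x∉Γ ∘ Any.map (λ {φ} → occursIn-⊕ (pos φ) u x∉u) ∘ map⁻

  fresh-⇑ : ∀ {x} s Γ Δ → ¬ x occursIn u → Fresh x s Γ Δ → Fresh x (s ⊕ u) (⇑ Γ) (⇑ Δ)
  fresh-⇑ s Γ Δ x∉u (x∉s , x∉Γ , x∉Δ) =
    x∉s ∘ occursIn-⊕ s u x∉u , freshFor-⇑ Γ x∉u x∉Γ , freshFor-⇑ Δ x∉u x∉Δ

  splitL : ∀ Γ {Π Δ} → ⇑ (Γ ++ Π) ⊢ Δ → ⇑ Γ ++ ⇑ Π ⊢ Δ
  splitL Γ {Π} = subst (_⊢ _) (map-++ shift Γ Π)

  joinL : ∀ Γ {Π Δ} → ⇑ Γ ++ ⇑ Π ⊢ Δ → ⇑ (Γ ++ Π) ⊢ Δ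
  joinL Γ {Π} = subst (_⊢ _) (sym (map-++ shift Γ Π))

  joinR : ∀ Δ {Σ Γ} → Γ ⊢ ⇑ Δ ++ ⇑ Σ → Γ ⊢ ⇑ (Δ ++ Σ)
  joinR Δ {Σ} = subst (_ ⊢_) (sym (map-++ shift Δ Σ))

  splitR : ∀ Δ {Σ Γ} → Γ ⊢ ⇑ (Δ ++ Σ) → Γ ⊢ ⇑ Δ ++ ⇑ Σ
  splitR Δ {Σ} = subst (_ ⊢_) (map-++ shift Δ Σ)

  moveL : ∀ {Γ Δ A p q} → p ≡ q → Γ ++ [ A ^ p ] ⊢ Δ → Γ ++ [ A ^ q ] ⊢ Δ
  moveL {Γ} {Δ} {A} = subst (λ p → Γ ++ [ A ^ p ] ⊢ Δ)

  moveR : ∀ {Γ Δ A p q} → p ≡ q → Γ ⊢ (A ^ p) ∷ Δ → Γ ⊢ (A ^ q) ∷ Δ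
  moveR {Γ} {Δ} {A} = subst (λ p → Γ ⊢ (A ^ p) ∷ Δ)

  -- A premise whose active formula sits at s ⊕ t becomes, after the
  -- shift, a premise of the same rule applied at s ⊕ u.
  premiseL : ∀ {Γ Δ A} s t → ⇑ (Γ ++ [ A ^ (s ⊕ t) ]) ⊢ Δ → ⇑ Γ ++ [ A ^ ((s ⊕ u) ⊕ t) ] ⊢ Δ
  premiseL {Γ} s t = moveL (⊕-rightComm s t u) ∘ splitL Γ

  premiseR : ∀ {Γ Δ A} s t → Γ ⊢ (A ^ ((s ⊕ t) ⊕ u)) ∷ Δ → Γ ⊢ (A ^ ((s ⊕ u) ⊕ t)) ∷ Δ
  premiseR s t = moveR (⊕-rightComm s t u)

  ind-step : ∀ s x → ((s ⊕ₜ x) ⊕ₙ 1) ⊕ u ≡ ((s ⊕ u) ⊕ₜ x) ⊕ₙ 1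
  ind-step s x = trans (⊕-rightComm (s ⊕ₜ x) ⟨ 1 , ∅ ⟩ u)
                       (cong (_⊕ₙ 1) (⊕-rightComm s ⟨ 0 , ｛ x ｝ ⟩ u))

  shiftᵈ : ∀ {Γ Δ} (d : Γ ⊢ Δ) → Admissible d → ⇑ Γ ⊢ ⇑ Δ
  shiftᵈ ax _ = ax
  shiftᵈ (cut {Γ} {Δ} {Π} d e) a =
    joinL Π (joinR Δ (cut (shiftᵈ d (++⁻ˡ _ a)) (splitL Π (shiftᵈ e (++⁻ʳ (eigentokens d) a)))))
  shiftᵈ (wkL {Γ} d) a = joinL Γ (wkL (shiftᵈ d a))
  shiftᵈ (wkR d) a = wkR (shiftᵈ d a)
  shiftᵈ (ctrL {Γ} d) a = joinL Γ (ctrL (splitL Γ (shiftᵈ d a)))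
  shiftᵈ (ctrR d) a = ctrR (shiftᵈ d a)
  shiftᵈ (exL {Γ} d) a = joinL Γ (exL (splitL Γ (shiftᵈ d a)))
  shiftᵈ (exR {Δ = Δ} d) a = joinR Δ (exR (splitR Δ (shiftᵈ d a)))
  shiftᵈ (¬L {Γ} d) a = joinL Γ (¬L (shiftᵈ d a))
  shiftᵈ (¬R {Γ} d) a = ¬R (splitL Γ (shiftᵈ d a))
  shiftᵈ (∧L₁ {Γ} d) a = joinL Γ (∧L₁ (splitL Γ (shiftᵈ d a)))
  shiftᵈ (∧L₂ {Γ} d) a = joinL Γ (∧L₂ (splitL Γ (shiftᵈ d a)))
  shiftᵈ (∧R d e) a = ∧R (shiftᵈ d (++⁻ˡ _ a)) (shiftᵈ e (++⁻ʳ (eigentokens d) a))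
  shiftᵈ (∨L {Γ} d e) a =
    joinL Γ (∨L (splitL Γ (shiftᵈ d (++⁻ˡ _ a))) (splitL Γ (shiftᵈ e (++⁻ʳ (eigentokens d) a))))
  shiftᵈ (∨R₁ d) a = ∨R₁ (shiftᵈ d a)
  shiftᵈ (∨R₂ d) a = ∨R₂ (shiftᵈ d a)
  shiftᵈ (⇒L {Γ} {Δ} {Π} d e) a =
    joinL (Π ++ Γ) (joinR Δ (subst (λ Θ → Θ ++ _ ⊢ _) (sym (map-++ shift Π Γ))
      (⇒L (shiftᵈ d (++⁻ˡ _ a)) (splitL Π (shiftᵈ e (++⁻ʳ (eigentokens d) a))))))
  shiftᵈ (⇒R {Γ} d) a = ⇒R (splitL Γ (shiftᵈ d a))
  shiftᵈ (□L {Γ} {s = s} t d) a = joinL Γ (□L t (premiseL s t (shiftᵈ d a)))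
  shiftᵈ (□R {Γ} {Δ} {s = s} x fresh d) (x∉u ∷ a) =
    □R x (fresh-⇑ s Γ Δ x∉u fresh) (premiseR s ⟨ 0 , ｛ x ｝ ⟩ (shiftᵈ d a))
  shiftᵈ (◇L {Γ} {Δ} {s = s} x fresh d) (x∉u ∷ a) =
    joinL Γ (◇L x (fresh-⇑ s Γ Δ x∉u fresh) (premiseL s ⟨ 0 , ｛ x ｝ ⟩ (shiftᵈ d a)))
  shiftᵈ (◇R {s = s} t d) a = ◇R t (premiseR s t (shiftᵈ d a))
  shiftᵈ (○L {Γ} {s = s} d) a = joinL Γ (○L (premiseL s ⟨ 1 , ∅ ⟩ (shiftᵈ d a)))
  shiftᵈ (○R {s = s} d) a = ○R (premiseR s ⟨ 1 , ∅ ⟩ (shiftᵈ d a))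
  shiftᵈ (ind {Γ} {Δ} {s = s} x t fresh d) (x∉u ∷ a) =
    joinL Γ (moveR (sym (⊕-rightComm s t u))
      (ind x t (fresh-⇑ s Γ Δ x∉u fresh)
        (moveR (ind-step s x) (premiseL s ⟨ 0 , ｛ x ｝ ⟩ (shiftᵈ d a)))))

open Shift using (shiftᵈ)

next-admissible : ∀ {Γ Δ} (d : Γ ⊢ Δ) → Shift.Admissible ⟨ 1 , ∅ ⟩ d
next-admissible d = All.tabulate λ _ ()

below-fresh : ∀ {Γ Δ} (d : Γ ⊢ Δ) → All (_< suc (max 0 (eigentokens d))) (eigentokens d)
below-fresh d = All.map s≤s (xs≤max 0 (eigentokens d))

mainTheorem15 : ∀ (A : Formula) → [] ⊢ (A ^ pos₀) ∷ [] →
    ([] ⊢ ((□ A) ^ pos₀) ∷ []) × ([] ⊢ ((○ A) ^ pos₀) ∷ [])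
mainTheorem15 A d =
    □R x ((λ ()) , (λ ()) , (λ ())) (shiftᵈ ⟨ 0 , ｛ x ｝ ⟩ d x-admissible)
  , ○R (shiftᵈ ⟨ 1 , ∅ ⟩ d (next-admissible d))
  where
  x : Token
  x = suc (max 0 (eigentokens d))

  x-admissible : Shift.Admissible ⟨ 0 , ｛ x ｝ ⟩ d
  x-admissible = All.map <-notIn-singleton (below-fresh d)
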